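{- The maximum, over all $10$-element subsets $S\subseteq \mathbb{F}_3^4$, of the number of sets contained in $S$ is $12$.
   Context: Cards of the game SET (with $4$ properties, each taking $3$ values) are identified with points of $\mathbb{F}_3^4$. A set is a $3$-element subset $\{p,q,r\}$ of distinct points of $\mathbb{F}_3^4$ with $p+q+r=0$ (equivalently, an affine line in $\mathbb{F}_3^4$). The number of sets contained in $S$ is the number of $3$-element subsets of $S$ that are sets. -}

module Defs where

open import Data.Nat using (ℕ; zero; suc)
open import Data.Fin using (Fin; zero; suc)
open import Data.Vec using (Vec; zipWith; replicate)
open import Data.List using (List; []; _∷_; length; filter)
open import Data.List.Relation.Unary.Unique.Propositional using (Unique)
open import Data.Vec.Properties using (≡-dec)
open import Data.Fin.Properties using (_≟_)
open import Relation.Binary.PropositionalEquality using (_≡_)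
open import Relation.Nullary using (Dec)
open import Data.Product using (_×_; _,_)

F3 : Set
F3 = Fin 3

_+₃_ : F3 → F3 → F3
zero +₃ b = b
suc zero +₃ zero = suc zero
suc zero +₃ suc zero = suc (suc zero)
suc zero +₃ suc (suc zero) = zero
suc (suc zero) +₃ zero = suc (suc zero)
suc (suc zero) +₃ suc zero = zero
suc (suc zero) +₃ suc (suc zero) = suc zero

Point : Set
Point = Vec F3 4

_⊕_ : Point → Point → Point
_⊕_ = zipWith _+₃_

𝟎 : Point
𝟎 = replicate 4 zero

-- A triple (of distinct points) is a set iff p + q + r = 0.
IsSet : Point → Point → Point → Set
IsSet p q r = (p ⊕ q) ⊕ r ≡ 𝟎

isSet? : (p q r : Point) → Dec (IsSet p q r)
isSet? p q r = ≡-dec _≟_ ((p ⊕ q) ⊕ r) 𝟎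

triples : List Point → List (Point × Point × Point)
triples [] = []
triples (p ∷ ps) = pairsWith p ps Data.List.++ triples ps
  where
  pairsWith : Point → List Point → List (Point × Point × Point)
  pairsWith p [] = []
  pairsWith p (q ∷ qs) = Data.List.map (λ r → p , q , r) qs Data.List.++ pairsWith p qs

-- A finite subset S of F_3^4 is represented as a duplicate-free list.
-- Number of sets contained in S = number of its 3-element subsets that are sets.
numSets : List Point → ℕ
numSets S = length (filter (λ { (p , q , r) → isSet? p q r }) (triples S))

-- If every point of S lies on at most 3 sets of S, then S has at most 10 sets, since
-- summing these degrees over S counts every set three times. Otherwise some point p lies
-- on four sets {p, uᵢ, vᵢ}, which use all points of S but one, x.
--
-- In the frame p; u₁ − p, …, u₄ − p, x − p three points of S form a set exactly when
-- their coefficient vectors in F3⁵ sum into the kernel Z of the coordinate map, and as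
-- the points are distinct, Z is a code of minimum weight 3. Apart from the 4 triples
-- through p, a triple can only be a set if its sum lies in one of fourteen groups of
-- vectors at pairwise distance at most 2, each meeting Z at most once: six groups for
-- the triples containing x and eight for the triples among the uᵢ and vᵢ. Such a code
-- has dimension at most 2, so once Z meets the first six groups it meets the other eight
-- in at most 2 vectors, and S has at most 4 + max(8, 6 + 2) = 12 sets.
-- Equality holds for an affine plane together with one point off it.

module Submission where

open import Defs
open import Data.Nat using (ℕ; _≤_)
open import Data.List using (List; length)
open import Data.List.Relation.Unary.Unique.Propositional using (Unique)
open import Data.Product using (_×_; Σ; ∃)
open import Relation.Binary.PropositionalEquality using (_≡_)

open import Data.Nat using (zero; suc; _+_; _*_; _<_; _<?_; _≤?_; _≟_; z≤n; s≤s)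

open import Data.Nat.Properties
  using (+-mono-≤; +-monoʳ-≤; ≤-reflexive; ≤-trans; ≤-pred; ≰⇒>; *-cancelˡ-≤; +-cancelˡ-≡; n≢0⇒n>0;
         module ≤-Reasoning)
import Data.Nat.Properties as ℕ
import Algebra.Properties.CommutativeSemigroup ℕ.+-commutativeSemigroup as ℕ+
open import Data.Nat.ListAction using (sum)
open import Data.Nat.Tactic.RingSolver using (solve-∀)
open import Data.Fin using (Fin; #_) renaming (zero to fzero; suc to fsuc)
open import Data.Fin.Properties using () renaming (_≟_ to _≟₃_; all? to all₃?; any? to any₃?)
open import Data.Vec using (Vec; []; _∷_; zipWith; replicate; lookup; _[_]≔_) renaming (map to mapᵥ)
open import Data.Vec.Properties using (∷-injective; ≡-dec)
import Data.Vec.Relation.Unary.All as Vec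
open import Data.List using ([]; _∷_; _++_; [_]; filter; map; concat; concatMap; allFin)
open import Data.List.Properties
  using (filter-++; length-++; filter-none; filter-accept; filter-reject; map-++; map-∘; map-cong; ++-cancelʳ;
         length-filter)
open import Data.List.Relation.Unary.All as All using (All; []; _∷_; all?)
open import Data.List.Relation.Unary.All.Properties using (¬Any⇒All¬)
open import Data.List.Relation.Unary.AllPairs as AllPairs using (AllPairs; []; _∷_; allPairs?)
open import Data.List.Relation.Unary.Any as Any using (Any; here; there; _─_)
open import Data.List.Relation.Unary.Unique.DecPropositional {A = Point} (≡-dec _≟₃_) using (unique?)
open import Data.List.Membership.Propositional using (_∈_; find)
open import Data.List.Membership.Propositional.Properties using (∈-filter⁻; ∈-map⁻; ∈-++⁻)
open import Data.List.Relation.Binary.Permutation.Propositional as ↭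
  using (_↭_; ↭-refl; ↭-sym; ↭-trans; ↭-prep; ↭-swap; ↭⇒↭ₛ)
open import Data.List.Relation.Binary.Permutation.Propositional.Properties using (filter-↭; ↭-length; map⁺)
import Data.List.Relation.Binary.Permutation.Setoid.Properties as PermutationSetoid
open import Data.Maybe as Maybe using (Maybe; just; nothing; from-just)
open import Data.Product using (_,_; proj₁; proj₂; ∃₂; ∃-syntax; uncurry)
open import Data.Sum using (_⊎_; inj₁; inj₂)
open import Data.Empty using (⊥)
open import Function using (_∘_; _⇔_; mk⇔; Equivalence)
open import Relation.Nullary using (Dec; yes; no; ¬_; contradiction)
open import Relation.Nullary.Decidable using (from-yes; map′; _×-dec_; _⊎-dec_; _→-dec_)
open import Relation.Unary using (Pred; Decidable; ∁)
open import Relation.Binary.Definitions using (DecidableEquality)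
open import Relation.Binary.PropositionalEquality using (_≢_; refl; sym; trans; cong; cong₂; subst; setoid)
open import Relation.Binary.PropositionalEquality.Properties using (module ≡-Reasoning)

private
  variable
    A B : Set
    n : ℕ
    x : A
    xs ys : List A

pattern 𝟘 = fzero
pattern 𝟙 = fsuc fzero
pattern 𝟚 = fsuc (fsuc fzero)

infixl 30 _*₃_
_*₃_ : F3 → F3 → F3
𝟘 *₃ b = 𝟘
𝟙 *₃ b = b
𝟚 *₃ 𝟘 = 𝟘
𝟚 *₃ 𝟙 = 𝟚
𝟚 *₃ 𝟚 = 𝟙

module Scalar where

  +-comm : ∀ a b → a +₃ b ≡ b +₃ a
  +-comm = from-yes (all₃? λ a → all₃? λ b → a +₃ b ≟₃ b +₃ a)

  +-swapʳ : ∀ a b c → (a +₃ b) +₃ c ≡ (a +₃ c) +₃ b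
  +-swapʳ = from-yes (all₃? λ a → all₃? λ b → all₃? λ c → (a +₃ b) +₃ c ≟₃ (a +₃ c) +₃ b)

  +-interchange : ∀ a b c d → (a +₃ b) +₃ (c +₃ d) ≡ (a +₃ c) +₃ (b +₃ d)
  +-interchange = from-yes (all₃? λ a → all₃? λ b → all₃? λ c → all₃? λ d →
    (a +₃ b) +₃ (c +₃ d) ≟₃ (a +₃ c) +₃ (b +₃ d))

  +-identityʳ : ∀ a → a +₃ 𝟘 ≡ a
  +-identityʳ = from-yes (all₃? λ a → a +₃ 𝟘 ≟₃ a)

  *-zeroʳ : ∀ a → a *₃ 𝟘 ≡ 𝟘
  *-zeroʳ = from-yes (all₃? λ a → a *₃ 𝟘 ≟₃ 𝟘)

  *-assoc : ∀ a b c → a *₃ (b *₃ c) ≡ (a *₃ b) *₃ c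
  *-assoc = from-yes (all₃? λ a → all₃? λ b → all₃? λ c → a *₃ (b *₃ c) ≟₃ (a *₃ b) *₃ c)

  *-distribˡ-+ : ∀ a b c → a *₃ (b +₃ c) ≡ (a *₃ b) +₃ (a *₃ c)
  *-distribˡ-+ = from-yes (all₃? λ a → all₃? λ b → all₃? λ c → a *₃ (b +₃ c) ≟₃ (a *₃ b) +₃ (a *₃ c))

  *-distribʳ-+ : ∀ a b c → (a +₃ b) *₃ c ≡ (a *₃ c) +₃ (b *₃ c)
  *-distribʳ-+ = from-yes (all₃? λ a → all₃? λ b → all₃? λ c → (a +₃ b) *₃ c ≟₃ (a *₃ c) +₃ (b *₃ c))

  +-translate₃ : ∀ p a b c → ((p +₃ a) +₃ (p +₃ b)) +₃ (p +₃ c) ≡ (a +₃ b) +₃ c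
  +-translate₃ = from-yes (all₃? λ p → all₃? λ a → all₃? λ b → all₃? λ c →
    ((p +₃ a) +₃ (p +₃ b)) +₃ (p +₃ c) ≟₃ (a +₃ b) +₃ c)

  x+[y−x]≡y : ∀ a b → a +₃ (b +₃ 𝟚 *₃ a) ≡ b
  x+[y−x]≡y = from-yes (all₃? λ a → all₃? λ b → a +₃ (b +₃ 𝟚 *₃ a) ≟₃ b)

  x−[y−x]≡z : ∀ a b c → (a +₃ b) +₃ c ≡ 𝟘 → a +₃ 𝟚 *₃ (b +₃ 𝟚 *₃ a) ≡ c
  x−[y−x]≡z = from-yes (all₃? λ a → all₃? λ b → all₃? λ c →
    ((a +₃ b) +₃ c ≟₃ 𝟘) →-dec (a +₃ 𝟚 *₃ (b +₃ 𝟚 *₃ a) ≟₃ c))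

  x−y≡0⇒x≡y : ∀ a b → a +₃ 𝟚 *₃ b ≡ 𝟘 → a ≡ b
  x−y≡0⇒x≡y = from-yes (all₃? λ a → all₃? λ b → (a +₃ 𝟚 *₃ b ≟₃ 𝟘) →-dec (a ≟₃ b))

  x+x+y≡0⇒x≡y : ∀ a b → (a +₃ a) +₃ b ≡ 𝟘 → a ≡ b
  x+x+y≡0⇒x≡y = from-yes (all₃? λ a → all₃? λ b → ((a +₃ a) +₃ b ≟₃ 𝟘) →-dec (a ≟₃ b))

  third-unique : ∀ a b c d → (a +₃ b) +₃ c ≡ 𝟘 → (a +₃ b) +₃ d ≡ 𝟘 → c ≡ d
  third-unique = from-yes (all₃? λ a → all₃? λ b → all₃? λ c → all₃? λ d →
    ((a +₃ b) +₃ c ≟₃ 𝟘) →-dec (((a +₃ b) +₃ d ≟₃ 𝟘) →-dec (c ≟₃ d)))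

infixl 6 _⊞_ _−_
infixr 7 _·_

_⊞_ : Vec F3 n → Vec F3 n → Vec F3 n
_⊞_ = zipWith _+₃_

_·_ : F3 → Vec F3 n → Vec F3 n
α · v = mapᵥ (α *₃_) v

_−_ : Vec F3 n → Vec F3 n → Vec F3 n
u − v = u ⊞ 𝟚 · v

zeros : ∀ n → Vec F3 n
zeros n = replicate n 𝟘

⊞-comm : (u v : Vec F3 n) → u ⊞ v ≡ v ⊞ u
⊞-comm [] [] = refl
⊞-comm (a ∷ u) (b ∷ v) = cong₂ _∷_ (Scalar.+-comm a b) (⊞-comm u v)

⊞-swapʳ : (u v w : Vec F3 n) → u ⊞ v ⊞ w ≡ u ⊞ w ⊞ v
⊞-swapʳ [] [] [] = refl
⊞-swapʳ (a ∷ u) (b ∷ v) (c ∷ w) = cong₂ _∷_ (Scalar.+-swapʳ a b c) (⊞-swapʳ u v w)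

⊞-interchange : (u v w z : Vec F3 n) → (u ⊞ v) ⊞ (w ⊞ z) ≡ (u ⊞ w) ⊞ (v ⊞ z)
⊞-interchange [] [] [] [] = refl
⊞-interchange (a ∷ u) (b ∷ v) (c ∷ w) (d ∷ z) = cong₂ _∷_ (Scalar.+-interchange a b c d) (⊞-interchange u v w z)

⊞-identityʳ : (u : Vec F3 n) → u ⊞ zeros n ≡ u
⊞-identityʳ [] = refl
⊞-identityʳ (a ∷ u) = cong₂ _∷_ (Scalar.+-identityʳ a) (⊞-identityʳ u)

⊞-identityˡ : (u : Vec F3 n) → zeros n ⊞ u ≡ u
⊞-identityˡ [] = refl
⊞-identityˡ (a ∷ u) = cong (a ∷_) (⊞-identityˡ u)

·-zeroˡ : (u : Vec F3 n) → 𝟘 · u ≡ zeros n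
·-zeroˡ [] = refl
·-zeroˡ (a ∷ u) = cong (𝟘 ∷_) (·-zeroˡ u)

·-zeroʳ : ∀ α → α · zeros n ≡ zeros n
·-zeroʳ {zero} α = refl
·-zeroʳ {suc n} α = cong₂ _∷_ (Scalar.*-zeroʳ α) (·-zeroʳ α)

·-identityˡ : (u : Vec F3 n) → 𝟙 · u ≡ u
·-identityˡ [] = refl
·-identityˡ (a ∷ u) = cong (a ∷_) (·-identityˡ u)

·-assoc : ∀ α β (u : Vec F3 n) → α · β · u ≡ (α *₃ β) · u
·-assoc α β [] = refl
·-assoc α β (a ∷ u) = cong₂ _∷_ (Scalar.*-assoc α β a) (·-assoc α β u)

·-distribˡ-⊞ : ∀ α (u v : Vec F3 n) → α · (u ⊞ v) ≡ α · u ⊞ α · v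
·-distribˡ-⊞ α [] [] = refl
·-distribˡ-⊞ α (a ∷ u) (b ∷ v) = cong₂ _∷_ (Scalar.*-distribˡ-+ α a b) (·-distribˡ-⊞ α u v)

·-distribʳ-+₃ : ∀ α β (u : Vec F3 n) → (α +₃ β) · u ≡ α · u ⊞ β · u
·-distribʳ-+₃ α β [] = refl
·-distribʳ-+₃ α β (a ∷ u) = cong₂ _∷_ (Scalar.*-distribʳ-+ α β a) (·-distribʳ-+₃ α β u)

⊞-translate₃ : (p u v w : Vec F3 n) → (p ⊞ u) ⊞ (p ⊞ v) ⊞ (p ⊞ w) ≡ u ⊞ v ⊞ w
⊞-translate₃ [] [] [] [] = refl
⊞-translate₃ (a ∷ p) (b ∷ u) (c ∷ v) (d ∷ w) = cong₂ _∷_ (Scalar.+-translate₃ a b c d) (⊞-translate₃ p u v w)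

x+[y−x]≡y : (u v : Vec F3 n) → u ⊞ (v − u) ≡ v
x+[y−x]≡y [] [] = refl
x+[y−x]≡y (a ∷ u) (b ∷ v) = cong₂ _∷_ (Scalar.x+[y−x]≡y a b) (x+[y−x]≡y u v)

x−[y−x]≡z : (u v w : Vec F3 n) → u ⊞ v ⊞ w ≡ zeros n → u − (v − u) ≡ w
x−[y−x]≡z [] [] [] _ = refl
x−[y−x]≡z (a ∷ u) (b ∷ v) (c ∷ w) e =
  cong₂ _∷_ (Scalar.x−[y−x]≡z a b c (proj₁ (∷-injective e))) (x−[y−x]≡z u v w (proj₂ (∷-injective e)))

x−y≡0⇒x≡y : (u v : Vec F3 n) → u − v ≡ zeros n → u ≡ v
x−y≡0⇒x≡y [] [] _ = refl
x−y≡0⇒x≡y (a ∷ u) (b ∷ v) e =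
  cong₂ _∷_ (Scalar.x−y≡0⇒x≡y a b (proj₁ (∷-injective e))) (x−y≡0⇒x≡y u v (proj₂ (∷-injective e)))

x+x+y≡0⇒x≡y : (u v : Vec F3 n) → u ⊞ u ⊞ v ≡ zeros n → u ≡ v
x+x+y≡0⇒x≡y [] [] _ = refl
x+x+y≡0⇒x≡y (a ∷ u) (b ∷ v) e =
  cong₂ _∷_ (Scalar.x+x+y≡0⇒x≡y a b (proj₁ (∷-injective e))) (x+x+y≡0⇒x≡y u v (proj₂ (∷-injective e)))

⊞-third-unique : (u v w z : Vec F3 n) → u ⊞ v ⊞ w ≡ zeros n → u ⊞ v ⊞ z ≡ zeros n → w ≡ z
⊞-third-unique [] [] [] [] _ _ = refl
⊞-third-unique (a ∷ u) (b ∷ v) (c ∷ w) (d ∷ z) e e′ =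
  cong₂ _∷_ (Scalar.third-unique a b c d (proj₁ (∷-injective e)) (proj₁ (∷-injective e′)))
            (⊞-third-unique u v w z (proj₂ (∷-injective e)) (proj₂ (∷-injective e′)))

count : ∀ {ℓ} {P : Pred A ℓ} → Decidable P → List A → ℕ
count P? xs = length (filter P? xs)

module _ {ℓ} {P : Pred A ℓ} (P? : Decidable P) where

  count-++ : ∀ xs ys → count P? (xs ++ ys) ≡ count P? xs + count P? ys
  count-++ xs ys = trans (cong length (filter-++ P? xs ys)) (length-++ (filter P? xs))

  count-↭ : xs ↭ ys → count P? xs ≡ count P? ys
  count-↭ σ = ↭-length (filter-↭ P? σ)

  count-none : All (∁ P) xs → count P? xs ≡ 0
  count-none ¬ps = cong length (filter-none P? ¬ps)

  count-accept : P x → count P? (x ∷ xs) ≡ suc (count P? xs)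
  count-accept px = cong length (filter-accept P? px)

  count-reject : ¬ P x → count P? (x ∷ xs) ≡ count P? xs
  count-reject ¬px = cong length (filter-reject P? ¬px)

  count-≤1 : AllPairs (λ x y → P x → P y → ⊥) xs → count P? xs ≤ 1
  count-≤1 [] = z≤n
  count-≤1 {x ∷ xs} (excl ∷ excls) with P? x
  ... | yes px = ≤-reflexive (cong suc (count-none (All.map (λ e → e px) excl)))
  ... | no _ = count-≤1 excls

  count-concat-≤ : ∀ {xss} → All (λ xs → count P? xs ≤ 1) xss → count P? (concat xss) ≤ length xss
  count-concat-≤ [] = z≤n
  count-concat-≤ {xs ∷ xss} (c ∷ cs) rewrite count-++ xs (concat xss) = +-mono-≤ c (count-concat-≤ cs)

  count-witness : 0 < count P? xs → ∃ λ x → x ∈ xs × P x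
  count-witness {xs} pos with filter P? xs in eq
  ... | y ∷ _ = y , ∈-filter⁻ P? (subst (y ∈_) (sym eq) (here refl))

count-map : ∀ {ℓ} {P : Pred A ℓ} (P? : Decidable P) (f : B → A) xs → count P? (map f xs) ≡ count (P? ∘ f) xs
count-map P? f [] = refl
count-map P? f (x ∷ xs) with P? (f x)
... | yes _ = cong suc (count-map P? f xs)
... | no _ = count-map P? f xs

count-cong : ∀ {ℓ ℓ′} {P : Pred A ℓ} {Q : Pred A ℓ′} (P? : Decidable P) (Q? : Decidable Q) →
             (∀ x → P x ⇔ Q x) → ∀ xs → count P? xs ≡ count Q? xs
count-cong P? Q? P⇔Q [] = refl
count-cong P? Q? P⇔Q (x ∷ xs) with P? x | Q? x
... | yes _ | yes _ = cong suc (count-cong P? Q? P⇔Q xs)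
... | no _ | no _ = count-cong P? Q? P⇔Q xs
... | yes px | no ¬qx = contradiction (Equivalence.to (P⇔Q x) px) ¬qx
... | no ¬px | yes qx = contradiction (Equivalence.from (P⇔Q x) qx) ¬px

─-↭ : (x∈ : x ∈ xs) → xs ↭ x ∷ (xs ─ x∈)
─-↭ (here refl) = ↭-refl
─-↭ {xs = y ∷ _} (there x∈) = ↭-trans (↭-prep y (─-↭ x∈)) (↭-swap y _ ↭-refl)

data SubBag {ℓ} (Q : Pred A ℓ) : List A → List A → Set ℓ where
  []   : SubBag Q [] ys
  skip : Q x → SubBag Q xs ys → SubBag Q (x ∷ xs) ys
  keep : (x∈ : x ∈ ys) → SubBag Q xs (ys ─ x∈) → SubBag Q (x ∷ xs) ys

findSubBag : ∀ {ℓ} {Q : Pred A ℓ} → Decidable Q → DecidableEquality A → ∀ xs ys → Maybe (SubBag Q xs ys)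
findSubBag Q? _≟_ [] ys = just []
findSubBag Q? _≟_ (x ∷ xs) ys with Q? x
... | yes qx = Maybe.map (skip qx) (findSubBag Q? _≟_ xs ys)
... | no _ with Any.any? (x ≟_) ys
...   | yes x∈ = Maybe.map (keep x∈) (findSubBag Q? _≟_ xs (ys ─ x∈))
...   | no _ = nothing

count-mono-SubBag : ∀ {ℓ ℓ′} {P : Pred A ℓ} {Q : Pred A ℓ′} (P? : Decidable P) →
                    (∀ {x} → Q x → ¬ P x) → SubBag Q xs ys → count P? xs ≤ count P? ys
count-mono-SubBag P? Q⇒¬P [] = z≤n
count-mono-SubBag P? Q⇒¬P (skip qx sb) =
  ≤-trans (≤-reflexive (count-reject P? (Q⇒¬P qx))) (count-mono-SubBag P? Q⇒¬P sb)
count-mono-SubBag {xs = x ∷ xs} P? Q⇒¬P (keep x∈ sb) rewrite count-↭ P? (─-↭ x∈) with P? x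
... | yes _ = s≤s (count-mono-SubBag P? Q⇒¬P sb)
... | no _ = count-mono-SubBag P? Q⇒¬P sb

sum-map-+ : (f g : A → ℕ) (xs : List A) → sum (map (λ x → f x + g x) xs) ≡ sum (map f xs) + sum (map g xs)
sum-map-+ f g [] = refl
sum-map-+ f g (x ∷ xs) rewrite sum-map-+ f g xs = ℕ+.interchange (f x) (g x) (sum (map f xs)) (sum (map g xs))

sum-map-≤ : ∀ (f : A → ℕ) {k xs} → All (λ x → f x ≤ k) xs → sum (map f xs) ≤ k * length xs
sum-map-≤ f {k} [] rewrite ℕ.*-zeroʳ k = z≤n
sum-map-≤ f {k} {_ ∷ xs} (fx≤k ∷ fxs≤k) rewrite ℕ.*-suc k (length xs) = +-mono-≤ fx≤k (sum-map-≤ f fxs≤k)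

Unique-resp-↭ : ∀ {A : Set} {xs ys : List A} → xs ↭ ys → Unique xs → Unique ys
Unique-resp-↭ {A = A} σ = PermutationSetoid.Unique-resp-↭ (setoid A) (↭⇒↭ₛ σ)

-- Pairs, triples and triple systems

pairsOf : List A → List (A × A)
pairsOf [] = []
pairsOf (x ∷ xs) = map (x ,_) xs ++ pairsOf xs

triplesOf : List A → List (A × A × A)
triplesOf [] = []
triplesOf (x ∷ xs) = map (x ,_) (pairsOf xs) ++ triplesOf xs

pairsOf-map : (f : A → B) (xs : List A) → pairsOf (map f xs) ≡ map (λ (x , y) → f x , f y) (pairsOf xs)
pairsOf-map f [] = refl
pairsOf-map f (x ∷ xs) = begin
  map (f x ,_) (map f xs) ++ pairsOf (map f xs)
    ≡⟨ cong₂ _++_ (sym (map-∘ xs)) (pairsOf-map f xs) ⟩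
  map (λ y → f x , f y) xs ++ map _ (pairsOf xs)
    ≡⟨ cong (_++ _) (map-∘ xs) ⟩
  map _ (map (x ,_) xs) ++ map _ (pairsOf xs)
    ≡⟨ map-++ _ (map (x ,_) xs) (pairsOf xs) ⟨
  map _ (map (x ,_) xs ++ pairsOf xs) ∎
  where open ≡-Reasoning

triplesOf-map : (f : A → B) (xs : List A) →
                triplesOf (map f xs) ≡ map (λ (x , y , z) → f x , f y , f z) (triplesOf xs)
triplesOf-map f [] = refl
triplesOf-map f (x ∷ xs) = begin
  map (f x ,_) (pairsOf (map f xs)) ++ triplesOf (map f xs)
    ≡⟨ cong₂ _++_ (cong (map (f x ,_)) (pairsOf-map f xs)) (triplesOf-map f xs) ⟩
  map (f x ,_) (map _ (pairsOf xs)) ++ map _ (triplesOf xs)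
    ≡⟨ cong (_++ _) (trans (sym (map-∘ (pairsOf xs))) (map-∘ (pairsOf xs))) ⟩
  map _ (map (x ,_) (pairsOf xs)) ++ map _ (triplesOf xs)
    ≡⟨ map-++ _ (map (x ,_) (pairsOf xs)) (triplesOf xs) ⟨
  map _ (map (x ,_) (pairsOf xs) ++ triplesOf xs) ∎
  where open ≡-Reasoning

∈-pairsOf⇒↭ : ∀ {x y : A} {zs} → (x , y) ∈ pairsOf zs → ∃ λ ys → zs ↭ x ∷ y ∷ ys
∈-pairsOf⇒↭ {zs = z ∷ zs} xy∈ with ∈-++⁻ (map (z ,_) zs) xy∈
... | inj₁ xy∈map with ∈-map⁻ (z ,_) xy∈map
...   | y , y∈ , refl = _ , ↭-prep z (─-↭ y∈)
∈-pairsOf⇒↭ {zs = z ∷ zs} xy∈ | inj₂ xy∈pairs with ∈-pairsOf⇒↭ xy∈pairs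
... | ys , σ = z ∷ ys , ↭-trans (↭-prep z σ) (↭-trans (↭-swap z _ ↭-refl) (↭-prep _ (↭-swap z _ ↭-refl)))

Unique-map-pairsOf : ∀ (f : A → B) {xs x y} → Unique (map f xs) → (x , y) ∈ pairsOf xs → f x ≢ f y
Unique-map-pairsOf f u xy∈ with _ , σ ← ∈-pairsOf⇒↭ xy∈ with (fx≢fy ∷ _) ∷ _ ← Unique-resp-↭ (map⁺ f σ) u
  = fx≢fy

module _ {ℓ} {S : A → A → Set ℓ} (S? : ∀ x y → Dec (S x y)) where

  pairCount : List A → ℕ
  pairCount xs = count (λ (x , y) → S? x y) (pairsOf xs)

  pairCount-∷ : ∀ x xs → pairCount (x ∷ xs) ≡ count (S? x) xs + pairCount xs
  pairCount-∷ x xs = begin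
    pairCount (x ∷ xs)
      ≡⟨ count-++ _ (map (x ,_) xs) (pairsOf xs) ⟩
    count _ (map (x ,_) xs) + pairCount xs
      ≡⟨ cong (_+ pairCount xs) (count-map _ (x ,_) xs) ⟩
    count (S? x) xs + pairCount xs ∎
    where open ≡-Reasoning

  private
    sum-count-[_] : ∀ y xs → sum (map (λ x → count (S? x) [ y ]) xs) ≡ count (λ x → S? x y) xs
    sum-count-[ y ] [] = refl
    sum-count-[ y ] (x ∷ xs) with S? x y
    ... | yes _ = cong suc (sum-count-[ y ] xs)
    ... | no _ = sum-count-[ y ] xs

  sum-count≡2*pairCount : (∀ {x y} → S x y → S y x) → ∀ xs → All (λ x → ¬ S x x) xs →
                          sum (map (λ x → count (S? x) xs) xs) ≡ 2 * pairCount xs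
  sum-count≡2*pairCount S-sym [] [] = refl
  sum-count≡2*pairCount S-sym (y ∷ xs) (¬Syy ∷ ¬Sxx) = begin
    count (S? y) (y ∷ xs) + sum (map (λ x → count (S? x) (y ∷ xs)) xs)
      ≡⟨ cong (λ s → count (S? y) (y ∷ xs) + sum s) (map-cong (λ x → count-++ (S? x) [ y ] xs) xs) ⟩
    count (S? y) (y ∷ xs) + sum (map (λ x → count (S? x) [ y ] + count (S? x) xs) xs)
      ≡⟨ cong₂ _+_ (count-reject (S? y) ¬Syy) (sum-map-+ _ _ xs) ⟩
    count (S? y) xs + (sum (map (λ x → count (S? x) [ y ]) xs) + sum (map (λ x → count (S? x) xs) xs))
      ≡⟨ cong (λ c → count (S? y) xs + (c + _)) (sum-count-[ y ] xs) ⟩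
    count (S? y) xs + (count (λ x → S? x y) xs + sum (map (λ x → count (S? x) xs) xs))
      ≡⟨ cong₂ (λ c s → count (S? y) xs + (c + s))
               (count-cong _ (S? y) (λ _ → mk⇔ S-sym S-sym) xs) (sum-count≡2*pairCount S-sym xs ¬Sxx) ⟩
    count (S? y) xs + (count (S? y) xs + 2 * pairCount xs)
      ≡⟨ double (count (S? y) xs) (pairCount xs) ⟩
    2 * (count (S? y) xs + pairCount xs)
      ≡⟨ cong (2 *_) (pairCount-∷ y xs) ⟨
    2 * pairCount (y ∷ xs) ∎
    where
    open ≡-Reasoning
    double : ∀ c p → c + (c + 2 * p) ≡ 2 * (c + p)
    double = solve-∀

  private
    count-[]-sym : (∀ {x y} → S x y → S y x) → ∀ x y → count (S? x) [ y ] ≡ count (S? y) [ x ]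
    count-[]-sym S-sym x y with S? x y | S? y x
    ... | yes _ | yes _ = refl
    ... | no _ | no _ = refl
    ... | yes sxy | no ¬syx = contradiction (S-sym sxy) ¬syx
    ... | no ¬sxy | yes syx = contradiction (S-sym syx) ¬sxy

  pairCount-↭ : (∀ {x y} → S x y → S y x) → ∀ {xs ys} → xs ↭ ys → pairCount xs ≡ pairCount ys
  pairCount-↭ S-sym ↭.refl = refl
  pairCount-↭ S-sym (↭.prep {xs} {ys} x σ) = begin
    pairCount (x ∷ xs)              ≡⟨ pairCount-∷ x xs ⟩
    count (S? x) xs + pairCount xs  ≡⟨ cong₂ _+_ (count-↭ (S? x) σ) (pairCount-↭ S-sym σ) ⟩
    count (S? x) ys + pairCount ys  ≡⟨ pairCount-∷ x ys ⟨
    pairCount (x ∷ ys)              ∎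
    where open ≡-Reasoning
  pairCount-↭ S-sym (↭.swap {xs} {ys} x y σ) = begin
    pairCount (x ∷ y ∷ xs)
      ≡⟨ trans (pairCount-∷ x (y ∷ xs)) (cong₂ _+_ (count-++ (S? x) [ y ] xs) (pairCount-∷ y xs)) ⟩
    (count (S? x) [ y ] + count (S? x) xs) + (count (S? y) xs + pairCount xs)
      ≡⟨ ℕ+.interchange (count (S? x) [ y ]) _ _ _ ⟩
    (count (S? x) [ y ] + count (S? y) xs) + (count (S? x) xs + pairCount xs)
      ≡⟨ cong₂ _+_ (cong₂ _+_ (count-[]-sym S-sym x y) (count-↭ (S? y) σ))
                   (cong₂ _+_ (count-↭ (S? x) σ) (pairCount-↭ S-sym σ)) ⟩
    (count (S? y) [ x ] + count (S? y) ys) + (count (S? x) ys + pairCount ys)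
      ≡⟨ trans (pairCount-∷ y (x ∷ ys)) (cong₂ _+_ (count-++ (S? y) [ x ] ys) (pairCount-∷ x ys)) ⟨
    pairCount (y ∷ x ∷ ys) ∎
    where open ≡-Reasoning
  pairCount-↭ S-sym (↭.trans σ τ) = trans (pairCount-↭ S-sym σ) (pairCount-↭ S-sym τ)

flatten : ∀ {k} → Vec (A × A) k → List A
flatten [] = []
flatten ((x , y) ∷ ps) = x ∷ y ∷ flatten ps

module TripleSystem {A : Set} {ℓ} (R : A → A → A → Set ℓ) (R? : ∀ x y z → Dec (R x y z))
  (R-swap₁₂ : ∀ {x y z} → R x y z → R y x z)
  (R-swap₂₃ : ∀ {x y z} → R x y z → R x z y)
  (R-repeated : ∀ {x y} → R x x y → x ≡ y)
  (R-third : ∀ {x y z w} → R x y z → R x y w → z ≡ w) where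

  degree : A → List A → ℕ
  degree x = pairCount (R? x)

  tripleCount : List A → ℕ
  tripleCount xs = count (λ (x , y , z) → R? x y z) (triplesOf xs)

  tripleCount-∷ : ∀ x xs → tripleCount (x ∷ xs) ≡ degree x xs + tripleCount xs
  tripleCount-∷ x xs = trans (count-++ _ (map (x ,_) (pairsOf xs)) (triplesOf xs))
                             (cong (_+ tripleCount xs) (count-map _ (x ,_) (pairsOf xs)))

  degree-↭ : ∀ x {xs ys} → xs ↭ ys → degree x xs ≡ degree x ys
  degree-↭ x = pairCount-↭ (R? x) R-swap₂₃

  tripleCount-↭ : ∀ {xs ys} → xs ↭ ys → tripleCount xs ≡ tripleCount ys
  tripleCount-↭ ↭.refl = refl
  tripleCount-↭ (↭.prep {xs} {ys} x σ) = begin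
    tripleCount (x ∷ xs)             ≡⟨ tripleCount-∷ x xs ⟩
    degree x xs + tripleCount xs     ≡⟨ cong₂ _+_ (degree-↭ x σ) (tripleCount-↭ σ) ⟩
    degree x ys + tripleCount ys     ≡⟨ tripleCount-∷ x ys ⟨
    tripleCount (x ∷ ys)             ∎
    where open ≡-Reasoning
  tripleCount-↭ (↭.swap {xs} {ys} x y σ) = begin
    tripleCount (x ∷ y ∷ xs)
      ≡⟨ trans (tripleCount-∷ x (y ∷ xs)) (cong₂ _+_ (pairCount-∷ (R? x) y xs) (tripleCount-∷ y xs)) ⟩
    (count (R? x y) xs + degree x xs) + (degree y xs + tripleCount xs)
      ≡⟨ ℕ+.interchange (count (R? x y) xs) _ _ _ ⟩
    (count (R? x y) xs + degree y xs) + (degree x xs + tripleCount xs)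
      ≡⟨ cong₂ _+_ (cong₂ _+_ (trans (count-cong (R? x y) (R? y x) (λ _ → mk⇔ R-swap₁₂ R-swap₁₂) xs)
                                     (count-↭ (R? y x) σ))
                              (degree-↭ y σ))
                   (cong₂ _+_ (degree-↭ x σ) (tripleCount-↭ σ)) ⟩
    (count (R? y x) ys + degree y ys) + (degree x ys + tripleCount ys)
      ≡⟨ trans (tripleCount-∷ y (x ∷ ys)) (cong₂ _+_ (pairCount-∷ (R? y) x ys) (tripleCount-∷ x ys)) ⟨
    tripleCount (y ∷ x ∷ ys) ∎
    where open ≡-Reasoning
  tripleCount-↭ (↭.trans σ τ) = trans (tripleCount-↭ σ) (tripleCount-↭ τ)

  degree-self : ∀ {x xs} → All (x ≢_) xs → degree x (x ∷ xs) ≡ degree x xs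
  degree-self {x} {xs} x∉ = trans (pairCount-∷ (R? x) x xs)
    (cong (_+ degree x xs) (count-none (R? x x) (All.map (λ x≢y Rxxy → x≢y (R-repeated Rxxy)) x∉)))

  sum-degree : ∀ {xs} → Unique xs → sum (map (λ x → degree x xs) xs) ≡ 3 * tripleCount xs
  sum-degree [] = refl
  sum-degree {x ∷ xs} (x∉ ∷ u) = begin
    degree x (x ∷ xs) + sum (map (λ y → degree y (x ∷ xs)) xs)
      ≡⟨ cong₂ _+_ (degree-self x∉) (cong sum (map-cong (λ y → pairCount-∷ (R? y) x xs) xs)) ⟩
    degree x xs + sum (map (λ y → count (R? y x) xs + degree y xs) xs)
      ≡⟨ cong (degree x xs +_) (sum-map-+ _ _ xs) ⟩
    degree x xs + (sum (map (λ y → count (R? y x) xs) xs) + sum (map (λ y → degree y xs) xs))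
      ≡⟨ cong₂ (λ a b → degree x xs + (a + b)) setsThroughX (sum-degree u) ⟩
    degree x xs + (2 * degree x xs + 3 * tripleCount xs)
      ≡⟨ triple (degree x xs) (tripleCount xs) ⟩
    3 * (degree x xs + tripleCount xs)
      ≡⟨ cong (3 *_) (tripleCount-∷ x xs) ⟨
    3 * tripleCount (x ∷ xs) ∎
    where
    open ≡-Reasoning
    triple : ∀ d t → d + (2 * d + 3 * t) ≡ 3 * (d + t)
    triple = solve-∀
    setsThroughX : sum (map (λ y → count (R? y x) xs) xs) ≡ 2 * degree x xs
    setsThroughX = trans
      (cong sum (map-cong (λ y → count-cong (R? y x) (R? x y) (λ _ → mk⇔ R-swap₁₂ R-swap₁₂) xs) xs))
      (sum-count≡2*pairCount (R? x) R-swap₂₃ xs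
        (All.map (λ x≢y Rxyy → x≢y (sym (R-repeated (R-swap₂₃ (R-swap₁₂ Rxyy))))) x∉))

  setThrough : ∀ x xs → 0 < degree x xs → ∃₂ λ y z → ∃ λ ys → xs ↭ y ∷ z ∷ ys × R x y z
  setThrough x xs pos with count-witness (λ (y , z) → R? x y z) {pairsOf xs} pos
  ... | (y , z) , yz∈ , Rxyz with ∈-pairsOf⇒↭ yz∈
  ...   | ys , σ = y , z , ys , σ , Rxyz

  degree-removeSet : ∀ {x y z ys} → Unique (y ∷ z ∷ ys) → R x y z → degree x (y ∷ z ∷ ys) ≡ suc (degree x ys)
  degree-removeSet {x} {y} {z} {ys} ((_ ∷ y∉) ∷ (z∉ ∷ _)) Rxyz = begin
    degree x (y ∷ z ∷ ys)
      ≡⟨ trans (pairCount-∷ (R? x) y (z ∷ ys)) (cong (count (R? x y) (z ∷ ys) +_) (pairCount-∷ (R? x) z ys)) ⟩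
    count (R? x y) (z ∷ ys) + (count (R? x z) ys + degree x ys)
      ≡⟨ cong₂ (λ a b → a + (b + degree x ys)) (trans (count-accept (R? x y) Rxyz) (cong suc onlyZ)) onlyY ⟩
    suc (degree x ys) ∎
    where
    open ≡-Reasoning
    onlyZ : count (R? x y) ys ≡ 0
    onlyZ = count-none (R? x y) (All.map (λ z≢w Rxyw → z≢w (R-third Rxyz Rxyw)) z∉)
    onlyY : count (R? x z) ys ≡ 0
    onlyY = count-none (R? x z) (All.map (λ y≢w Rxzw → y≢w (R-third (R-swap₂₃ Rxyz) Rxzw)) y∉)

  pencil : ∀ k x {xs} → Unique xs → k ≤ degree x xs →
           ∃₂ λ (ps : Vec (A × A) k) ys → xs ↭ flatten ps ++ ys × Vec.All (uncurry (R x)) ps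
  pencil zero x {xs} _ _ = [] , xs , ↭-refl , Vec.[]
  pencil (suc k) x {xs} u k<deg
    with y , z , ys , σ , Rxyz ← setThrough x xs (≤-trans (s≤s z≤n) k<deg)
    with u′@(_ ∷ _ ∷ uys) ← Unique-resp-↭ σ u
    with ps , zs , τ , Rps
           ← pencil k x uys (≤-pred (subst (suc k ≤_) (trans (degree-↭ x σ) (degree-removeSet u′ Rxyz)) k<deg))
    = (y , z) ∷ ps , zs , ↭-trans σ (↭-prep y (↭-prep z τ)) , Rxyz Vec.∷ Rps

  tripleCount-≤ : ∀ d {xs} → Unique xs → All (λ x → degree x xs ≤ d) xs → 3 * tripleCount xs ≤ d * length xs
  tripleCount-≤ d u degrees≤d = subst (_≤ d * _) (sum-degree u) (sum-map-≤ _ degrees≤d)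

-- Ternary codes of minimum weight 3 in F3⁵

V5 : Set
V5 = Vec F3 5

weight : Vec F3 n → ℕ
weight [] = 0
weight (𝟘 ∷ v) = weight v
weight (fsuc _ ∷ v) = suc (weight v)

LowWeight : Vec F3 n → Set
LowWeight v = 0 < weight v × weight v ≤ 2

lowWeight? : Decidable (LowWeight {n})
lowWeight? v = (0 <? weight v) ×-dec (weight v ≤? 2)

record IsSubspace (Z : Vec F3 n → Set) : Set where
  field
    ⊞-closed : ∀ {u v} → Z u → Z v → Z (u ⊞ v)
    ·-closed : ∀ α {u} → Z u → Z (α · u)

LowDifference : Vec F3 n → Vec F3 n → Set
LowDifference c d = LowWeight (c − d)

LowCombination : Vec F3 n → Vec F3 n → Vec F3 n → Set
LowCombination z c d = ∃[ α ] ∃[ β ] ∃[ γ ] LowWeight (α · c ⊞ β · d ⊞ γ · z)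

lowCombination? : (z c d : Vec F3 n) → Dec (LowCombination z c d)
lowCombination? z c d = any₃? λ α → any₃? λ β → any₃? λ γ → lowWeight? (α · c ⊞ β · d ⊞ γ · z)

all-vectors? : {P : Vec F3 n → Set} → Decidable P → Dec (∀ v → P v)
all-vectors? {zero} P? = map′ (λ p → λ { [] → p }) (λ ∀p → ∀p []) (P? [])
all-vectors? {suc n} P? = map′ (λ ∀p → λ { (a ∷ v) → ∀p v a }) (λ ∀p v a → ∀p (a ∷ v))
  (all-vectors? λ v → all₃? λ a → P? (a ∷ v))

e : Fin n → Vec F3 n
e i = zeros _ [ i ]≔ 𝟙

-- Coordinates of p, u₁, v₁, …, u₄, v₄, x in the frame p; u₁ − p, …, u₄ − p, x − p,
-- where vᵢ = p − (uᵢ − p) since p + uᵢ + vᵢ = 0.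
pencilCoords : List V5
pencilCoords = zeros 5 ∷ e (# 0) ∷ 𝟚 · e (# 0) ∷ e (# 1) ∷ 𝟚 · e (# 1)
             ∷ e (# 2) ∷ 𝟚 · e (# 2) ∷ e (# 3) ∷ 𝟚 · e (# 3) ∷ e (# 4) ∷ []

tripleSums : List V5 → List V5
tripleSums ks = map (λ (a , b , c) → a ⊞ b ⊞ c) (triplesOf ks)

Difference : List V5 → V5 → Set
Difference K f = Any (λ (a , b) → f ≡ a − b ⊎ f ≡ b − a) (pairsOf K)

lowWeight⇒difference : ∀ f → LowWeight f → Difference pencilCoords f
lowWeight⇒difference = from-yes (all-vectors? λ f → lowWeight? f →-dec
  Any.any? (λ (a , b) → ≡-dec _≟₃_ f (a − b) ⊎-dec ≡-dec _≟₃_ f (b − a)) (pairsOf pencilCoords))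

signed : (F3 → F3 → V5) → List V5
signed f = concatMap (λ α → map (f α) (𝟙 ∷ 𝟚 ∷ [])) (𝟙 ∷ 𝟚 ∷ [])

indexPairs : List (Fin 5 × Fin 5)
indexPairs = (# 0 , # 1) ∷ (# 0 , # 2) ∷ (# 0 , # 3) ∷ (# 1 , # 2) ∷ (# 1 , # 3) ∷ (# 2 , # 3) ∷ []

indexTriples : List (Fin 5 × Fin 5 × Fin 5)
indexTriples = (# 0 , # 1 , # 2) ∷ (# 0 , # 1 , # 3) ∷ (# 0 , # 2 , # 3) ∷ (# 1 , # 2 , # 3) ∷ []

zeroSums : List V5
zeroSums = zeros 5 ∷ zeros 5 ∷ zeros 5 ∷ zeros 5 ∷ []

xGroups posGroups negGroups : List (List V5)
xGroups = map (λ (i , j) → signed λ α β → α · e i ⊞ β · e j ⊞ e (# 4)) indexPairs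
posGroups = map (λ (i , j , k) → signed λ α β → e i ⊞ α · e j ⊞ β · e k) indexTriples
negGroups = map (λ (i , j , k) → signed λ α β → 𝟚 · e i ⊞ α · e j ⊞ β · e k) indexTriples

tripleSums-subBag : SubBag LowWeight (tripleSums pencilCoords)
                                     (zeroSums ++ concat xGroups ++ concat posGroups ++ concat negGroups)
tripleSums-subBag = from-just (findSubBag lowWeight? (≡-dec _≟₃_) (tripleSums pencilCoords)
  (zeroSums ++ concat xGroups ++ concat posGroups ++ concat negGroups))

groups-lowDifference : All (AllPairs LowDifference) xGroups × All (AllPairs LowDifference) posGroups
                     × All (AllPairs LowDifference) negGroups
groups-lowDifference = from-yes (lowDifferences? xGroups ×-dec lowDifferences? posGroups ×-dec lowDifferences? negGroups)
  where
  lowDifferences? : Decidable (All (AllPairs LowDifference))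
  lowDifferences? = all? (allPairs? λ c d → lowWeight? (c − d))

-- A code of minimum weight 3 in F3⁵ has dimension at most 2 (Hamming bound), so once it
-- contains a vector of xGroups it contains at most one of posGroups and one of negGroups.
xSums-lowCombination : All (λ z → AllPairs (LowCombination z) (concat posGroups)
                                × AllPairs (LowCombination z) (concat negGroups)) (concat xGroups)
xSums-lowCombination = from-yes (all?
  (λ z → allPairs? (lowCombination? z) (concat posGroups) ×-dec allPairs? (lowCombination? z) (concat negGroups))
  (concat xGroups))

module _ {Z : V5 → Set} (Z? : Decidable Z) (Z-subspace : IsSubspace Z) (Z-heavy : ∀ {v} → Z v → ¬ LowWeight v) where

  open IsSubspace Z-subspace

  lowDifference-excl : ∀ {c d} → LowDifference c d → Z c → Z d → ⊥
  lowDifference-excl low zc zd = Z-heavy (⊞-closed zc (·-closed 𝟚 zd)) low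

  lowCombination-excl : ∀ {z c d} → Z z → LowCombination z c d → Z c → Z d → ⊥
  lowCombination-excl zz (α , β , γ , low) zc zd =
    Z-heavy (⊞-closed (⊞-closed (·-closed α zc) (·-closed β zd)) (·-closed γ zz)) low

  count-groups-≤ : ∀ {Gs} → All (AllPairs LowDifference) Gs → count Z? (concat Gs) ≤ length Gs
  count-groups-≤ sep = count-concat-≤ Z? (All.map (λ ps → count-≤1 Z? (AllPairs.map lowDifference-excl ps)) sep)

  count-lowCombination-≤1 : ∀ {z G} → Z z → AllPairs (LowCombination z) G → count Z? G ≤ 1
  count-lowCombination-≤1 zz combs = count-≤1 Z? (AllPairs.map (lowCombination-excl zz) combs)

  tripleSums-inCode-≤12 : count Z? (tripleSums pencilCoords) ≤ 12
  tripleSums-inCode-≤12 = begin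
    count Z? (tripleSums pencilCoords)
      ≤⟨ count-mono-SubBag Z? (λ low z → Z-heavy z low) tripleSums-subBag ⟩
    count Z? (zeroSums ++ concat xGroups ++ concat posGroups ++ concat negGroups)
      ≡⟨ trans (count-++ Z? zeroSums (concat xGroups ++ concat posGroups ++ concat negGroups))
           (cong (cZ +_) (trans (count-++ Z? (concat xGroups) (concat posGroups ++ concat negGroups))
             (cong (cX +_) (count-++ Z? (concat posGroups) (concat negGroups))))) ⟩
    cZ + (cX + (cP + cN))
      ≤⟨ byCases (cX ≟ 0) groups-lowDifference ⟩
    12 ∎
    where
    open ≤-Reasoning
    cZ cX cP cN : ℕ
    cZ = count Z? zeroSums
    cX = count Z? (concat xGroups)
    cP = count Z? (concat posGroups)
    cN = count Z? (concat negGroups)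
    byCases : Dec (cX ≡ 0) → All (AllPairs LowDifference) xGroups × All (AllPairs LowDifference) posGroups
                           × All (AllPairs LowDifference) negGroups → cZ + (cX + (cP + cN)) ≤ 12
    byCases (yes cX≡0) (_ , pSep , nSep) rewrite cX≡0 =
      +-mono-≤ (length-filter Z? zeroSums) (+-mono-≤ (count-groups-≤ pSep) (count-groups-≤ nSep))
    byCases (no cX≢0) (xSep , _) = withX (count-witness Z? (n≢0⇒n>0 cX≢0))
      where
      withX : (∃ λ z → z ∈ concat xGroups × Z z) → cZ + (cX + (cP + cN)) ≤ 12
      withX (z , z∈ , zz) = let pComb , nComb = All.lookup xSums-lowCombination z∈ in
        +-mono-≤ (length-filter Z? zeroSums) (+-mono-≤ (count-groups-≤ xSep)
          (+-mono-≤ (count-lowCombination-≤1 zz pComb) (count-lowCombination-≤1 zz nComb)))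

-- Sets of F3⁴ as a triple system

isSet-swap₁₂ : ∀ {p q r} → IsSet p q r → IsSet q p r
isSet-swap₁₂ {p} {q} {r} s = trans (cong (_⊞ r) (⊞-comm q p)) s

isSet-swap₂₃ : ∀ {p q r} → IsSet p q r → IsSet p r q
isSet-swap₂₃ {p} {q} {r} s = trans (⊞-swapʳ p r q) s

isSet-repeated : ∀ {p q} → IsSet p p q → p ≡ q
isSet-repeated = x+x+y≡0⇒x≡y _ _

isSet-third : ∀ {p q r s} → IsSet p q r → IsSet p q s → r ≡ s
isSet-third = ⊞-third-unique _ _ _ _

open TripleSystem IsSet isSet? isSet-swap₁₂ isSet-swap₂₃ isSet-repeated isSet-third

-- Defs builds the pairs through p with a local helper; its value is recovered by
-- cancelling triples qs in the equation for triples (p ∷ qs).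
triples-∷ : ∀ p qs → triples (p ∷ qs) ≡ map (p ,_) (pairsOf qs) ++ triples qs
triples-∷ p [] = refl
triples-∷ p (q ∷ qs) = begin
  (map (λ r → p , q , r) qs ++ _) ++ triples (q ∷ qs)
    ≡⟨ cong (λ ts → (map (λ r → p , q , r) qs ++ ts) ++ triples (q ∷ qs))
            (++-cancelʳ (triples qs) _ _ (triples-∷ p qs)) ⟩
  (map (λ r → p , q , r) qs ++ map (p ,_) (pairsOf qs)) ++ triples (q ∷ qs)
    ≡⟨ cong (λ ts → (ts ++ _) ++ triples (q ∷ qs)) (map-∘ qs) ⟩
  (map (p ,_) (map (q ,_) qs) ++ map (p ,_) (pairsOf qs)) ++ triples (q ∷ qs)
    ≡⟨ cong (_++ triples (q ∷ qs)) (map-++ (p ,_) (map (q ,_) qs) (pairsOf qs)) ⟨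
  map (p ,_) (pairsOf (q ∷ qs)) ++ triples (q ∷ qs) ∎
  where open ≡-Reasoning

triples≡triplesOf : ∀ ps → triples ps ≡ triplesOf ps
triples≡triplesOf [] = refl
triples≡triplesOf (p ∷ ps) = trans (triples-∷ p ps) (cong (map (p ,_) (pairsOf ps) ++_) (triples≡triplesOf ps))

numSets≡tripleCount : ∀ S → numSets S ≡ tripleCount S
numSets≡tripleCount S = cong (λ ts → length (filter _ ts)) (triples≡triplesOf S)

numSets-↭ : ∀ {S S′} → S ↭ S′ → numSets S ≡ numSets S′
numSets-↭ {S} {S′} σ = trans (numSets≡tripleCount S) (trans (tripleCount-↭ σ) (sym (numSets≡tripleCount S′)))

-- Coordinates on a pencil of four sets

lincomb : ∀ {m} → Vec F3 m → Vec (Vec F3 n) m → Vec F3 n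
lincomb [] [] = zeros _
lincomb (c ∷ cs) (w ∷ ws) = c · w ⊞ lincomb cs ws

module _ {n : ℕ} where

  lincomb-⊞ : ∀ {m} (c d : Vec F3 m) (ws : Vec (Vec F3 n) m) → lincomb (c ⊞ d) ws ≡ lincomb c ws ⊞ lincomb d ws
  lincomb-⊞ [] [] [] = sym (⊞-identityʳ (zeros n))
  lincomb-⊞ (c ∷ cs) (d ∷ ds) (w ∷ ws) =
    trans (cong₂ _⊞_ (·-distribʳ-+₃ c d w) (lincomb-⊞ cs ds ws)) (⊞-interchange (c · w) (d · w) _ _)

  lincomb-· : ∀ {m} α (c : Vec F3 m) (ws : Vec (Vec F3 n) m) → lincomb (α · c) ws ≡ α · lincomb c ws
  lincomb-· α [] [] = sym (·-zeroʳ α)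
  lincomb-· α (c ∷ cs) (w ∷ ws) =
    trans (cong₂ _⊞_ (sym (·-assoc α c w)) (lincomb-· α cs ws)) (sym (·-distribˡ-⊞ α (c · w) _))

  lincomb-− : ∀ {m} (c d : Vec F3 m) (ws : Vec (Vec F3 n) m) → lincomb (c − d) ws ≡ lincomb c ws − lincomb d ws
  lincomb-− c d ws = trans (lincomb-⊞ c (𝟚 · d) ws) (cong (lincomb c ws ⊞_) (lincomb-· 𝟚 d ws))

  lincomb-zeros : ∀ {m} (ws : Vec (Vec F3 n) m) → lincomb (zeros m) ws ≡ zeros n
  lincomb-zeros [] = refl
  lincomb-zeros (w ∷ ws) = trans (cong₂ _⊞_ (·-zeroˡ w) (lincomb-zeros ws)) (⊞-identityˡ (zeros n))

  lincomb-e : ∀ {m} (i : Fin m) (ws : Vec (Vec F3 n) m) → lincomb (e i) ws ≡ lookup ws i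
  lincomb-e fzero (w ∷ ws) = trans (cong₂ _⊞_ (·-identityˡ w) (lincomb-zeros ws)) (⊞-identityʳ w)
  lincomb-e (fsuc i) (w ∷ ws) = trans (cong₂ _⊞_ (·-zeroˡ w) (lincomb-e i ws)) (⊞-identityˡ (lookup ws i))

  Kernel : ∀ {m} → Vec (Vec F3 n) m → Vec F3 m → Set
  Kernel ws c = lincomb c ws ≡ zeros n

  kernel-subspace : ∀ {m} (ws : Vec (Vec F3 n) m) → IsSubspace (Kernel ws)
  kernel-subspace ws = record
    { ⊞-closed = λ {c} {d} zc zd → trans (lincomb-⊞ c d ws) (trans (cong₂ _⊞_ zc zd) (⊞-identityʳ (zeros n)))
    ; ·-closed = λ α {c} zc → trans (lincomb-· α c ws) (trans (cong (α ·_) zc) (·-zeroʳ α))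
    }

module Frame (p : Point) (ws : Vec Point 5) where

  point : V5 → Point
  point c = p ⊞ lincomb c ws

  kernel? : Decidable (Kernel ws)
  kernel? c = ≡-dec _≟₃_ (lincomb c ws) (zeros 4)

  isSet⇔kernel : ∀ a b c → IsSet (point a) (point b) (point c) ⇔ Kernel ws (a ⊞ b ⊞ c)
  isSet⇔kernel a b c = mk⇔ (trans (sym sum≡)) (trans sum≡)
    where
    sum≡ : point a ⊞ point b ⊞ point c ≡ lincomb (a ⊞ b ⊞ c) ws
    sum≡ = trans (⊞-translate₃ p (lincomb a ws) (lincomb b ws) (lincomb c ws))
                 (sym (trans (lincomb-⊞ (a ⊞ b) c ws) (cong (_⊞ lincomb c ws) (lincomb-⊞ a b ws))))

  numSets-points : ∀ K → numSets (map point K) ≡ count kernel? (tripleSums K)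
  numSets-points K = begin
    numSets (map point K)
      ≡⟨ numSets≡tripleCount (map point K) ⟩
    tripleCount (map point K)
      ≡⟨ cong (count _) (triplesOf-map point K) ⟩
    count _ (map _ (triplesOf K))
      ≡⟨ count-map _ _ (triplesOf K) ⟩
    count _ (triplesOf K)
      ≡⟨ count-cong _ _ (λ (a , b , c) → isSet⇔kernel a b c) (triplesOf K) ⟩
    count (λ (a , b , c) → kernel? (a ⊞ b ⊞ c)) (triplesOf K)
      ≡⟨ count-map kernel? _ (triplesOf K) ⟨
    count kernel? (tripleSums K) ∎
    where open ≡-Reasoning

  kernel-heavy : ∀ {K} → Unique (map point K) → (∀ v → LowWeight v → Difference K v) →
                 ∀ {v} → Kernel ws v → ¬ LowWeight v
  kernel-heavy u low⇒diff {v} kv low with (a , b) , ab∈ , v≡ ← find (low⇒diff v low)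
    = Unique-map-pairsOf point u ab∈ (point-≡ kv v≡)
    where
    lincomb-≡ : ∀ a b → Kernel ws (a − b) → lincomb a ws ≡ lincomb b ws
    lincomb-≡ a b k = x−y≡0⇒x≡y _ _ (trans (sym (lincomb-− a b ws)) k)
    point-≡ : ∀ {a b v} → Kernel ws v → v ≡ a − b ⊎ v ≡ b − a → point a ≡ point b
    point-≡ {a} {b} k (inj₁ refl) = cong (p ⊞_) (lincomb-≡ a b k)
    point-≡ {a} {b} k (inj₂ refl) = cong (p ⊞_) (sym (lincomb-≡ b a k))

numSets-pencil-≤12 : ∀ {p u₁ v₁ u₂ v₂ u₃ v₃ u₄ v₄ x} →
  IsSet p u₁ v₁ → IsSet p u₂ v₂ → IsSet p u₃ v₃ → IsSet p u₄ v₄ →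
  Unique (p ∷ u₁ ∷ v₁ ∷ u₂ ∷ v₂ ∷ u₃ ∷ v₃ ∷ u₄ ∷ v₄ ∷ x ∷ []) →
  numSets (p ∷ u₁ ∷ v₁ ∷ u₂ ∷ v₂ ∷ u₃ ∷ v₃ ∷ u₄ ∷ v₄ ∷ x ∷ []) ≤ 12
numSets-pencil-≤12 {p} {u₁} {v₁} {u₂} {v₂} {u₃} {v₃} {u₄} {v₄} {x} s₁ s₂ s₃ s₄ u =
  subst (_≤ 12) (trans (sym (numSets-points pencilCoords)) (cong numSets points≡))
    (tripleSums-inCode-≤12 kernel? (kernel-subspace ws)
      (λ {v} → kernel-heavy (subst Unique (sym points≡) u) lowWeight⇒difference {v}))
  where
  ws : Vec Point 5
  ws = u₁ − p ∷ u₂ − p ∷ u₃ − p ∷ u₄ − p ∷ x − p ∷ []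
  open Frame p ws
  point-u : ∀ i {u} → lookup ws i ≡ u − p → point (e i) ≡ u
  point-u i {u} w≡ = trans (cong (p ⊞_) (trans (lincomb-e i ws) w≡)) (x+[y−x]≡y p u)
  point-v : ∀ i {u v} → IsSet p u v → lookup ws i ≡ u − p → point (𝟚 · e i) ≡ v
  point-v i {u} {v} s w≡ =
    trans (cong (p ⊞_) (trans (lincomb-· 𝟚 (e i) ws) (cong (𝟚 ·_) (trans (lincomb-e i ws) w≡))))
          (x−[y−x]≡z p u v s)
  points≡ : map point pencilCoords ≡ p ∷ u₁ ∷ v₁ ∷ u₂ ∷ v₂ ∷ u₃ ∷ v₃ ∷ u₄ ∷ v₄ ∷ x ∷ []
  points≡ = cong₂ _∷_ (trans (cong (p ⊞_) (lincomb-zeros ws)) (⊞-identityʳ p))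
    (cong₂ _∷_ (point-u (# 0) refl) (cong₂ _∷_ (point-v (# 0) s₁ refl)
    (cong₂ _∷_ (point-u (# 1) refl) (cong₂ _∷_ (point-v (# 1) s₂ refl)
    (cong₂ _∷_ (point-u (# 2) refl) (cong₂ _∷_ (point-v (# 2) s₃ refl)
    (cong₂ _∷_ (point-u (# 3) refl) (cong₂ _∷_ (point-v (# 3) s₄ refl)
    (cong₂ _∷_ (point-u (# 4) refl) refl)))))))))

numSets-≤12-ofDegree≤3 : ∀ {S} → Unique S → length S ≡ 10 → All (λ q → degree q S ≤ 3) S → numSets S ≤ 12
numSets-≤12-ofDegree≤3 {S} u |S|≡10 degrees≤3 rewrite numSets≡tripleCount S =
  ≤-trans (*-cancelˡ-≤ 3 (subst (λ m → 3 * tripleCount S ≤ 3 * m) |S|≡10 (tripleCount-≤ 3 u degrees≤3)))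
          (+-monoʳ-≤ 10 z≤n)

length≡1 : (xs : List A) → length xs ≡ 1 → ∃ λ x → xs ≡ x ∷ []
length≡1 (x ∷ []) refl = x , refl

numSets-≤12-ofDegree≥4 : ∀ {S q} → Unique S → length S ≡ 10 → q ∈ S → 4 ≤ degree q S → numSets S ≤ 12
numSets-≤12-ofDegree≥4 {S} {q} u |S|≡10 q∈ deg≥4
  with q∉ ∷ uT ← Unique-resp-↭ (─-↭ q∈) u
  with (u₁ , v₁) ∷ (u₂ , v₂) ∷ (u₃ , v₃) ∷ (u₄ , v₄) ∷ [] , rest , τ , s₁ Vec.∷ s₂ Vec.∷ s₃ Vec.∷ s₄ Vec.∷ Vec.[]
         ← pencil 4 q uT (subst (4 ≤_) (trans (degree-↭ q (─-↭ q∈)) (degree-self q∉)) deg≥4)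
  with σ ← ↭-trans (─-↭ q∈) (↭-prep q τ)
  with x , refl ← length≡1 rest (+-cancelˡ-≡ 9 _ _ (trans (sym (↭-length σ)) |S|≡10))
  = subst (_≤ 12) (numSets-↭ (↭-sym σ)) (numSets-pencil-≤12 s₁ s₂ s₃ s₄ (Unique-resp-↭ σ u))

numSets-≤12 : (S : List Point) → Unique S → length S ≡ 10 → numSets S ≤ 12
numSets-≤12 S u |S|≡10 with Any.any? (λ q → 4 ≤? degree q S) S
... | yes rich = let q , q∈ , deg≥4 = find rich in numSets-≤12-ofDegree≥4 u |S|≡10 q∈ deg≥4
... | no ¬rich = numSets-≤12-ofDegree≤3 u |S|≡10 (All.map (λ deg≱4 → ≤-pred (≰⇒> deg≱4)) (¬Any⇒All¬ S ¬rich))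

planePlusPoint : List Point
planePlusPoint = (𝟘 ∷ 𝟘 ∷ 𝟙 ∷ 𝟘 ∷ []) ∷ concatMap (λ a → map (λ b → a ∷ b ∷ 𝟘 ∷ 𝟘 ∷ []) (allFin 3)) (allFin 3)

mainTheorem8 : ((S : List Point) → Unique S → length S ≡ 10 → numSets S ≤ 12)
    × (Σ (List Point) λ S → Unique S × length S ≡ 10 × numSets S ≡ 12)
mainTheorem8 = numSets-≤12 , planePlusPoint , from-yes (unique? planePlusPoint) , refl , refl
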